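{- Let $W_{\Delta,n}$ be a Knödel graph with $\Delta\ge 2$, and let $s=2^{\Delta-1}-1$. If $i=ks\le\lfloor n/4\rfloor$ for some positive integer $k$, then $d(u_0,u_i)=2k=\frac{2i}{s}$.
   Context: Knödel graph: for an even integer $n$ and an integer $\Delta$ with $1\le\Delta\le\lfloor\log_2 n\rfloor$, $W_{\Delta,n}$ is the simple bipartite graph with vertex set $U\cup V$, $U=\{u_0,\dots,u_{n/2-1}\}$, $V=\{v_0,\dots,v_{n/2-1}\}$; indices are read modulo $n/2$. The vertices $u_i$ and $v_j$ are adjacent iff $j-i\equiv 2^k-1\pmod{n/2}$ for some $k\in\{0,\dots,\Delta-1\}$; no other edges. $d(x,y)$ is the graph distance. -}

module Defs where

open import Data.Nat using (ℕ; zero; suc; _+_; _*_; _∸_; _^_; _≤_; _<_; _/_)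
open import Data.Fin using (Fin; toℕ)
open import Data.Product using (Σ; ∃; _×_; _,_)
open import Data.Sum using (_⊎_)
open import Data.Integer as ℤ using (ℤ; +_)
open import Data.Integer.Divisibility using () renaming (_∣_ to _∣ℤ_)

-- Vertices of the Knödel graph W_{Δ,n}, with m = n/2 vertices on each side:
-- u i  is u_i  and  v j  is v_j, indices in Fin m (i.e. read modulo m).
data Vertex (m : ℕ) : Set where
  u : Fin m → Vertex m
  v : Fin m → Vertex m

_≡_[mod_] : ℤ → ℤ → ℕ → Set
a ≡ b [mod m ] = (+ m) ∣ℤ (a ℤ.- b)

UVAdj : (Δ m : ℕ) → Fin m → Fin m → Set
UVAdj Δ m i j = Σ ℕ λ k → k < Δ × ((+ toℕ j) ℤ.- (+ toℕ i)) ≡ (+ (2 ^ k ∸ 1)) [mod m ]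

data Adj (Δ m : ℕ) : Vertex m → Vertex m → Set where
  uv : ∀ {i j} → UVAdj Δ m i j → Adj Δ m (u i) (v j)
  vu : ∀ {i j} → UVAdj Δ m i j → Adj Δ m (v j) (u i)

data Walk (Δ m : ℕ) : Vertex m → Vertex m → ℕ → Set where
  here : ∀ {x} → Walk Δ m x x 0
  step : ∀ {x y z L} → Adj Δ m x y → Walk Δ m y z L → Walk Δ m x z (suc L)

Dist : (Δ m : ℕ) → Vertex m → Vertex m → ℕ → Set
Dist Δ m x y L = Walk Δ m x y L × (∀ L' → Walk Δ m x y L' → L ≤ L')

module Submission where

-- Write m = n/2 for the number of vertices on each side.  The upper bound is
-- a "ladder": u_a – v_{a+s} – u_{a+s} is a walk of length 2 (offsets s and 0),
-- so k rungs reach u_{ks} in 2k steps as long as no index wraps around.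
--
-- The lower bound uses the potential ψ(u_i) = 2i, ψ(v_j) = 2j - s.  Every edge
-- uses an offset 2^κ - 1 ∈ [0, s], so it changes ψ by 2(2^κ - 1) - s ∈ [-s, s]
-- modulo 2m.  Hence a walk of length L changes ψ, modulo 2m, by an integer t
-- with |t| ≤ Ls ("near" relation below).  For a walk from u₀ to u_i with
-- i = ks ≤ n/4 and L < 2k we get 2i ≡ t (mod 2m) with |t| < 2i and
-- 2i + |t| < 4i ≤ 2m, which is impossible: 2i - t would be a nonzero multiple
-- of 2m of absolute value below 2m.

open import Defs
open import Data.Nat using (ℕ; _+_; _*_; _∸_; _^_; _≤_; _/_)
open import Data.Nat.Divisibility using (_∣_)
open import Data.Nat.Logarithm using (⌊log₂_⌋)
open import Data.Fin using (Fin; toℕ)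
open import Data.Product using (_×_)
open import Relation.Binary.PropositionalEquality using (_≡_)

open import Data.Nat as ℕ using (zero; suc; _<_; z≤n)
import Data.Nat.Properties as ℕ
import Data.Nat.Divisibility as ℕ
open import Data.Nat.DivMod using (m/n*n≤m; m*[n/m]≡n)
open import Data.Fin using (fromℕ<)
open import Data.Fin.Properties using (toℕ-injective; toℕ-fromℕ<; toℕ<n)
open import Data.Product using (_,_)
open import Data.Integer as ℤ using (ℤ; +_; ∣_∣; 0ℤ; _⊖_)
import Data.Integer.Properties as ℤ
import Data.Integer.Divisibility as Unsigned
open import Data.Integer.Divisibility.Signed using (∣ᵤ⇒∣; ∣⇒∣ᵤ; ∣m∣n⇒∣m+n; ∣m⇒∣-m)
open import Data.Integer.Tactic.RingSolver using (solve-∀)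
open import Data.Empty using (⊥)
open import Relation.Binary.PropositionalEquality using (refl; sym; trans; cong; subst; subst₂; module ≡-Reasoning)

≡mod-reflexive : ∀ {M a b} → a ≡ b → a ≡ b [mod M ]
≡mod-reflexive {M} {a} refl =
  subst (λ x → (+ M) Unsigned.∣ x) (sym (ℤ.+-inverseʳ a)) (ℕ.divides 0 refl)

≡mod-+ : ∀ {M a b c d} → a ≡ b [mod M ] → c ≡ d [mod M ] → (a ℤ.+ c) ≡ (b ℤ.+ d) [mod M ]
≡mod-+ {M} {a} {b} {c} {d} a≡b c≡d =
  subst (λ x → (+ M) Unsigned.∣ x) (regroup a b c d)
    (∣⇒∣ᵤ (∣m∣n⇒∣m+n (∣ᵤ⇒∣ {+ M} {a ℤ.- b} a≡b) (∣ᵤ⇒∣ {+ M} {c ℤ.- d} c≡d)))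
  where
  regroup : ∀ a b c d → (a ℤ.- b) ℤ.+ (c ℤ.- d) ≡ (a ℤ.+ c) ℤ.- (b ℤ.+ d)
  regroup = solve-∀

≡mod-neg : ∀ {M a b} → a ≡ b [mod M ] → (ℤ.- a) ≡ (ℤ.- b) [mod M ]
≡mod-neg {M} {a} {b} a≡b =
  subst (λ x → (+ M) Unsigned.∣ x) (negate a b) (∣⇒∣ᵤ (∣m⇒∣-m (∣ᵤ⇒∣ {+ M} {a ℤ.- b} a≡b)))
  where
  negate : ∀ a b → ℤ.- (a ℤ.- b) ≡ ℤ.- a ℤ.- ℤ.- b
  negate = solve-∀

≡mod-scale : ∀ c {M a b} → a ≡ b [mod M ] → (+ c ℤ.* a) ≡ (+ c ℤ.* b) [mod (c * M) ]
≡mod-scale c {M} {a} {b} a≡b =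
  subst₂ (Unsigned._∣_) (sym (ℤ.pos-* c M)) (distrib (+ c) a b)
    (Unsigned.*-monoʳ-∣ (+ c) a≡b)
  where
  distrib : ∀ c a b → c ℤ.* (a ℤ.- b) ≡ c ℤ.* a ℤ.- c ℤ.* b
  distrib = solve-∀

-- d is congruent modulo M to some integer of absolute value at most B.
-- (A record, so that d can be inferred from the type.)
record Near (M : ℕ) (d : ℤ) (B : ℕ) : Set where
  constructor near
  field
    residue   : ℤ
    congruent : d ≡ residue [mod M ]
    small     : ∣ residue ∣ ≤ B

near-+ : ∀ {M d e B C} → Near M d B → Near M e C → Near M (d ℤ.+ e) (B + C)
near-+ {d = d} {e} (near t d≡t ∣t∣≤B) (near r e≡r ∣r∣≤C) =
  near (t ℤ.+ r) (≡mod-+ {a = d} {t} {e} {r} d≡t e≡r)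
    (ℕ.≤-trans (ℤ.∣i+j∣≤∣i∣+∣j∣ t r) (ℕ.+-mono-≤ ∣t∣≤B ∣r∣≤C))

near-neg : ∀ {M d B} → Near M d B → Near M (ℤ.- d) B
near-neg {d = d} {B} (near t d≡t ∣t∣≤B) =
  near (ℤ.- t) (≡mod-neg {a = d} {t} d≡t) (subst (_≤ B) (sym (ℤ.∣-i∣≡∣i∣ t)) ∣t∣≤B)

-- A positive D is not congruent mod M to any t with |t| < D and D + |t| < M:
-- D - t is then nonzero and of absolute value below M.
residue-separation : ∀ {M D} t → (+ D) ≡ t [mod M ] → ∣ t ∣ < D → D + ∣ t ∣ < M → ⊥
residue-separation {M} {D} t M∣D-t ∣t∣<D fits with ∣ + D ℤ.- t ∣ in gap
... | zero = ℕ.<-irrefl (cong ∣_∣ t≡D) ∣t∣<D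
  where
  t≡D : t ≡ + D
  t≡D = sym (ℤ.i-j≡0⇒i≡j (+ D) t (ℤ.∣i∣≡0⇒i≡0 gap))
... | suc g = ℕ.<-irrefl refl (ℕ.≤-<-trans M≤gap (ℕ.≤-<-trans gap≤ fits))
  where
  M≤gap : M ≤ suc g
  M≤gap = ℕ.∣⇒≤ M∣D-t
  gap≤ : suc g ≤ D + ∣ t ∣
  gap≤ = subst (_≤ D + ∣ t ∣) gap (ℤ.∣i-j∣≤∣i∣+∣j∣ (+ D) t)

centred-offset-bound : ∀ {a s} → a ≤ s → ∣ + 2 ℤ.* + a ℤ.- + s ∣ ≤ s
centred-offset-bound {a} {s} a≤s =
  subst (λ x → ∣ x ∣ ≤ s) (sym centred)
    (ℕ.≤-trans (ℤ.∣m⊝n∣≤m⊔n a (s ∸ a)) (ℕ.⊔-lub a≤s (ℕ.m∸n≤m s a)))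
  where
  open ≡-Reasoning
  cancel : ∀ a r → + 2 ℤ.* a ℤ.- (a ℤ.+ r) ≡ a ℤ.- r
  cancel = solve-∀
  centred : + 2 ℤ.* + a ℤ.- + s ≡ a ⊖ (s ∸ a)
  centred = begin
    + 2 ℤ.* + a ℤ.- + s                 ≡⟨ cong (λ x → + 2 ℤ.* + a ℤ.- + x) (sym (ℕ.m+[n∸m]≡n a≤s)) ⟩
    + 2 ℤ.* + a ℤ.- + (a + (s ∸ a))     ≡⟨ cong (λ x → + 2 ℤ.* + a ℤ.- x) (ℤ.pos-+ a (s ∸ a)) ⟩
    + 2 ℤ.* + a ℤ.- (+ a ℤ.+ + (s ∸ a)) ≡⟨ cancel (+ a) (+ (s ∸ a)) ⟩
    + a ℤ.- + (s ∸ a)                   ≡⟨ ℤ.[+m]-[+n]≡m⊖n a (s ∸ a) ⟩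
    a ⊖ (s ∸ a)                         ∎

-- The largest edge offset of W_{Δ,·}: s = 2^(Δ-1) - 1.
span : ℕ → ℕ
span Δ = 2 ^ (Δ ∸ 1) ∸ 1

offset≤span : ∀ {κ Δ} → κ < Δ → 2 ^ κ ∸ 1 ≤ span Δ
offset≤span κ<Δ = ℕ.∸-monoˡ-≤ 1 (ℕ.^-monoʳ-≤ 2 (ℕ.∸-monoˡ-≤ 1 κ<Δ))

span-positive : ∀ {Δ} → 2 ≤ Δ → 1 ≤ span Δ
span-positive 2≤Δ = ℕ.∸-monoˡ-≤ 1 (ℕ.^-monoʳ-≤ 2 {1} (ℕ.∸-monoˡ-≤ 1 2≤Δ))

ψ : ∀ (Δ : ℕ) {m} → Vertex m → ℤ
ψ Δ (u i) = + 2 ℤ.* + toℕ i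
ψ Δ (v j) = + 2 ℤ.* + toℕ j ℤ.- + span Δ

edge-near : ∀ {Δ m x y} → Adj Δ m x y → Near (2 * m) (ψ Δ y ℤ.- ψ Δ x) (span Δ)
edge-near {Δ} {m} (uv {i} {j} (κ , κ<Δ , j-i≡offset)) = near t congruence (centred-offset-bound (offset≤span κ<Δ))
  where
  t : ℤ
  t = + 2 ℤ.* + (2 ^ κ ∸ 1) ℤ.- + span Δ
  rearrange : ∀ j i s → (+ 2 ℤ.* j ℤ.- s) ℤ.- + 2 ℤ.* i ≡ + 2 ℤ.* (j ℤ.- i) ℤ.- s
  rearrange = solve-∀
  congruence : (ψ Δ (v j) ℤ.- ψ Δ (u i)) ≡ t [mod (2 * m) ]
  congruence = subst (λ x → x ≡ t [mod (2 * m) ]) (sym (rearrange (+ toℕ j) (+ toℕ i) (+ span Δ)))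
    (≡mod-+ {a = + 2 ℤ.* (+ toℕ j ℤ.- + toℕ i)} {b = + 2 ℤ.* + (2 ^ κ ∸ 1)}
            (≡mod-scale 2 {m} {+ toℕ j ℤ.- + toℕ i} j-i≡offset)
            (≡mod-reflexive {a = ℤ.- + span Δ} refl))
edge-near {Δ} {m} (vu {i} {j} uvAdj) =
  subst (λ d → Near (2 * m) d (span Δ)) (flip (ψ Δ (v j)) (ψ Δ (u i)))
    (near-neg (edge-near (uv {i = i} {j} uvAdj)))
  where
  flip : ∀ a b → ℤ.- (a ℤ.- b) ≡ b ℤ.- a
  flip = solve-∀

walk-near : ∀ {Δ m x y L} → Walk Δ m x y L → Near (2 * m) (ψ Δ y ℤ.- ψ Δ x) (L * span Δ)
walk-near {Δ} {x = x} here = near 0ℤ (≡mod-reflexive (ℤ.+-inverseʳ (ψ Δ x))) z≤n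
walk-near {Δ} {m} {x} {z} {suc L} (step {y = y} e w) =
  subst (λ d → Near (2 * m) d (suc L * span Δ)) (telescope (ψ Δ x) (ψ Δ y) (ψ Δ z))
    (near-+ (edge-near e) (walk-near w))
  where
  telescope : ∀ a b c → (b ℤ.- a) ℤ.+ (c ℤ.- b) ≡ c ℤ.- a
  telescope = solve-∀

potential-gap : ∀ {Δ m} {a b : Fin m} {D} → toℕ b ≡ toℕ a + D →
  ψ Δ (u b) ℤ.- ψ Δ (u a) ≡ + (2 * D)
potential-gap {a = a} {b} {D} b≡a+D = begin
  + 2 ℤ.* + toℕ b ℤ.- + 2 ℤ.* + toℕ a              ≡⟨ cong (λ x → + 2 ℤ.* + x ℤ.- + 2 ℤ.* + toℕ a) b≡a+D ⟩
  + 2 ℤ.* + (toℕ a + D) ℤ.- + 2 ℤ.* + toℕ a        ≡⟨ cong (λ x → + 2 ℤ.* x ℤ.- + 2 ℤ.* + toℕ a) (ℤ.pos-+ (toℕ a) D) ⟩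
  + 2 ℤ.* (+ toℕ a ℤ.+ + D) ℤ.- + 2 ℤ.* + toℕ a   ≡⟨ cancel (+ toℕ a) (+ D) ⟩
  + 2 ℤ.* + D                                       ≡⟨ sym (ℤ.pos-* 2 D) ⟩
  + (2 * D)                                         ∎
  where
  open ≡-Reasoning
  cancel : ∀ a d → + 2 ℤ.* (a ℤ.+ d) ℤ.- + 2 ℤ.* a ≡ + 2 ℤ.* d
  cancel = solve-∀

walk-lower-bound : ∀ {Δ m L D} {a b : Fin m} → Walk Δ m (u a) (u b) L →
  toℕ b ≡ toℕ a + D → L * span Δ < 2 * D → 2 * D + L * span Δ < 2 * m → ⊥
walk-lower-bound {Δ} {m} {D = D} {a} {b} w b≡a+D short fits with walk-near w
... | near t gap≡t ∣t∣≤Ls =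
  residue-separation t
    (subst (λ d → d ≡ t [mod (2 * m) ]) (potential-gap {Δ} {a = a} {b} {D} b≡a+D) gap≡t)
    (ℕ.≤-<-trans ∣t∣≤Ls short)
    (ℕ.≤-<-trans (ℕ.+-monoʳ-≤ (2 * D) ∣t∣≤Ls) fits)

uv-exact : ∀ {Δ m κ} {i j : Fin m} → κ < Δ → toℕ j ≡ toℕ i + (2 ^ κ ∸ 1) → UVAdj Δ m i j
uv-exact {κ = κ} {i} {j} κ<Δ j≡i+offset = κ , κ<Δ , ≡mod-reflexive difference
  where
  open ≡-Reasoning
  cancel : ∀ i d → (i ℤ.+ d) ℤ.- i ≡ d
  cancel = solve-∀
  difference : + toℕ j ℤ.- + toℕ i ≡ + (2 ^ κ ∸ 1)
  difference = begin
    + toℕ j ℤ.- + toℕ i                      ≡⟨ cong (λ x → + x ℤ.- + toℕ i) j≡i+offset ⟩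
    + (toℕ i + (2 ^ κ ∸ 1)) ℤ.- + toℕ i      ≡⟨ cong (ℤ._- + toℕ i) (ℤ.pos-+ (toℕ i) _) ⟩
    (+ toℕ i ℤ.+ + (2 ^ κ ∸ 1)) ℤ.- + toℕ i  ≡⟨ cancel (+ toℕ i) _ ⟩
    + (2 ^ κ ∸ 1)                             ∎

rung : ∀ {Δ m L} {a b c : Fin m} → 1 ≤ Δ → toℕ c ≡ toℕ a + span Δ →
  Walk Δ m (u c) (u b) L → Walk Δ m (u a) (u b) (2 + L)
rung {Δ = suc δ} {c = c} _ c≡a+s rest =
  step (uv (uv-exact (ℕ.n<1+n δ) c≡a+s))
    (step (vu (uv-exact (ℕ.s≤s z≤n) (sym (ℕ.+-identityʳ (toℕ c))))) rest)

ladder : ∀ {Δ m} → 1 ≤ Δ → ∀ j (a b : Fin m) → toℕ b ≡ toℕ a + j * span Δ →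
  Walk Δ m (u a) (u b) (2 * j)
ladder _ zero a b b≡a
  rewrite toℕ-injective {i = b} {j = a} (trans b≡a (ℕ.+-identityʳ (toℕ a))) = here
ladder {Δ} {m} 1≤Δ (suc j) a b b≡a+js =
  subst (Walk Δ m (u a) (u b)) (sym (ℕ.*-suc 2 j))
    (rung 1≤Δ (toℕ-fromℕ< a+s<m) (ladder 1≤Δ j c b b≡c+js))
  where
  s : ℕ
  s = span Δ
  a+s<m : toℕ a + s < m
  a+s<m = ℕ.≤-<-trans (ℕ.≤-trans (ℕ.+-monoʳ-≤ (toℕ a) (ℕ.m≤m+n s (j * s)))
            (ℕ.≤-reflexive (sym b≡a+js)))
            (toℕ<n b)
  c : Fin m
  c = fromℕ< a+s<m
  b≡c+js : toℕ b ≡ toℕ c + j * s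
  b≡c+js = trans b≡a+js (trans (sym (ℕ.+-assoc (toℕ a) s (j * s)))
             (cong (_+ j * s) (sym (toℕ-fromℕ< a+s<m))))

quarter-fits : ∀ {n x} → 2 ∣ n → x ≤ n / 4 → 2 * x + 2 * x ≤ 2 * (n / 2)
quarter-fits {n} {x} 2∣n x≤n/4 = begin
  2 * x + 2 * x ≡⟨ sym (ℕ.*-distribʳ-+ x 2 2) ⟩
  4 * x         ≤⟨ ℕ.*-monoʳ-≤ 4 x≤n/4 ⟩
  4 * (n / 4)   ≡⟨ ℕ.*-comm 4 (n / 4) ⟩
  n / 4 * 4     ≤⟨ m/n*n≤m n 4 ⟩
  n             ≡⟨ sym (m*[n/m]≡n 2∣n) ⟩
  2 * (n / 2)   ∎
  where open ℕ.≤-Reasoning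

mainTheorem4 : (n Δ : ℕ) → 2 ∣ n → 2 ≤ Δ → Δ ≤ ⌊log₂ n ⌋ →
    (k : ℕ) → 1 ≤ k → (i₀ i : Fin (n / 2)) → toℕ i₀ ≡ 0 →
    toℕ i ≡ k * (2 ^ (Δ ∸ 1) ∸ 1) → toℕ i ≤ n / 4 →
    Dist Δ (n / 2) (u i₀) (u i) (2 * k)
      × (2 * k) * (2 ^ (Δ ∸ 1) ∸ 1) ≡ 2 * toℕ i
mainTheorem4 n Δ 2∣n 2≤Δ _ k _ i₀ i i₀≡0 i≡ks i≤n/4 = (ladder-walk , minimal) , doubled
  where
  s : ℕ
  s = span Δ
  instance
    s≢0 : ℕ.NonZero s
    s≢0 = ℕ.>-nonZero (span-positive 2≤Δ)
  i≡i₀+ks : toℕ i ≡ toℕ i₀ + k * s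
  i≡i₀+ks rewrite i₀≡0 = i≡ks
  doubled : 2 * k * s ≡ 2 * toℕ i
  doubled = trans (ℕ.*-assoc 2 k s) (cong (2 *_) (sym i≡ks))
  ladder-walk : Walk Δ (n / 2) (u i₀) (u i) (2 * k)
  ladder-walk = ladder (ℕ.≤-trans (ℕ.s≤s z≤n) 2≤Δ) k i₀ i i≡i₀+ks
  -- A shorter walk would satisfy L·s < 2i and 2i + L·s < 4i ≤ 2m.
  minimal : ∀ L → Walk Δ (n / 2) (u i₀) (u i) L → 2 * k ≤ L
  minimal L w = ℕ.≮⇒≥ λ L<2k →
    let short = subst (L * s <_) (ℕ.*-assoc 2 k s) (ℕ.*-monoˡ-< s L<2k)
    in walk-lower-bound w i≡i₀+ks short
         (ℕ.<-≤-trans (ℕ.+-monoʳ-< (2 * (k * s)) short)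
           (quarter-fits 2∣n (subst (_≤ n / 4) i≡ks i≤n/4)))
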